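{- Let $G=(V,E)$ be a graph. Then $k(G)\le \gamma_s(G)$; moreover, if $G$ has a split irredundant set then $k(G)\le ir_s(G)$, and if $G$ has a split independent set then $k(G)\le i_s(G)$.
   Context: All graphs are finite, undirected, simple, connected, with no isolated vertices. A vertex cut set is a set $S\subseteq V$ such that $G\setminus S$ is either a $K_1$ or disconnected; the connectivity $k(G)$ is the minimum size of a vertex cut set. $N[v]$ is the closed neighborhood, $N[S]=\bigcup_{v\in S}N[v]$; $S$ is dominating if $N[S]=V$; $S$ is independent if $\langle S\rangle$ has no edges. For $u\in S$, a private neighbor of $u$ with respect to $S$ is a vertex $w\in N[u]\setminus N[S\setminus\{u\}]$. Split dominating set: dominating $S$ with $\langle V\setminus S\rangle$ disconnected or a $K_1$; $\gamma_s(G)$ is the minimum size of a split dominating set. Split independent set: independent $S$ with $\langle V\setminus S\rangle$ disconnected or a $K_1$; it is maximal if for every $v\in V\setminus S$, either $S\cup\{v\}$ is not independent or $\langle V\setminus(S\cup\{v\})\rangle$ is connected; $i_s(G)$ is the minimum size of a maximal split independent set. Split irredundant set: $S$ such that every $u\in S$ has a private neighbor with respect to $S$ and $\langle V\setminus S\rangle$ is disconnected or a $K_1$; it is maximal if for every $v\in V\setminus S$, either $v$ has no private neighbor with respect to $S\cup\{v\}$ or $\langle V\setminus(S\cup\{v\})\rangle$ is connected; $ir_s(G)$ is the minimum size of a maximal split irredundant set. -}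

module Defs where

open import Data.Nat using (ℕ; _≤_)
open import Data.Fin using (Fin)
open import Data.Fin.Subset using (Subset; _∈_; _∉_; ∁; _∪_; ⁅_⁆; ∣_∣)
open import Data.Product using (Σ; _×_; ∃; ∃-syntax; _,_)
open import Data.Sum using (_⊎_)
open import Relation.Nullary using (¬_)
open import Relation.Binary.PropositionalEquality using (_≡_; _≢_)

record Graph (n : ℕ) : Set₁ where
  field
    Adj   : Fin n → Fin n → Set
    sym   : ∀ {u v} → Adj u v → Adj v u
    irrefl : ∀ {u} → ¬ Adj u u

module _ {n : ℕ} (G : Graph n) where
  open Graph G

  data Walk (U : Subset n) : Fin n → Fin n → Set where
    here : ∀ {u} → u ∈ U → Walk U u u
    step : ∀ {u w v} → u ∈ U → Adj u w → Walk U w v → Walk U u v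

  Connected : Subset n → Set
  Connected U = ∀ u v → u ∈ U → v ∈ U → Walk U u v

  Disconnected : Subset n → Set
  Disconnected U = ∃[ u ] ∃[ v ] (u ∈ U × v ∈ U × ¬ Walk U u v)

  IsK1 : Subset n → Set
  IsK1 U = ∣ U ∣ ≡ 1

  SplitComplement : Subset n → Set
  SplitComplement S = Disconnected (∁ S) ⊎ IsK1 (∁ S)

  NoIsolated : Set
  NoIsolated = ∀ v → ∃[ u ] Adj v u

  VertexCutSet : Subset n → Set
  VertexCutSet S = SplitComplement S

  InN : Fin n → Fin n → Set
  InN u w = w ≡ u ⊎ Adj u w

  InNSet : Subset n → Fin n → Set
  InNSet S w = ∃[ x ] (x ∈ S × InN x w)

  InNSetMinus : Subset n → Fin n → Fin n → Set
  InNSetMinus S u w = ∃[ x ] (x ∈ S × x ≢ u × InN x w)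

  Dominating : Subset n → Set
  Dominating S = ∀ w → InNSet S w

  Independent : Subset n → Set
  Independent S = ∀ u v → u ∈ S → v ∈ S → ¬ Adj u v

  PrivateNeighbor : Subset n → Fin n → Fin n → Set
  PrivateNeighbor S u w = InN u w × ¬ InNSetMinus S u w

  HasPrivateNeighbor : Subset n → Fin n → Set
  HasPrivateNeighbor S u = ∃[ w ] PrivateNeighbor S u w

  SplitDominating : Subset n → Set
  SplitDominating S = Dominating S × SplitComplement S

  SplitIndependent : Subset n → Set
  SplitIndependent S = Independent S × SplitComplement S

  MaximalSplitIndependent : Subset n → Set
  MaximalSplitIndependent S =
    SplitIndependent S ×
    (∀ v → v ∉ S → ¬ Independent (⁅ v ⁆ ∪ S) ⊎ Connected (∁ (⁅ v ⁆ ∪ S)))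

  SplitIrredundant : Subset n → Set
  SplitIrredundant S = (∀ u → u ∈ S → HasPrivateNeighbor S u) × SplitComplement S

  MaximalSplitIrredundant : Subset n → Set
  MaximalSplitIrredundant S =
    SplitIrredundant S ×
    (∀ v → v ∉ S → ¬ HasPrivateNeighbor (⁅ v ⁆ ∪ S) v ⊎ Connected (∁ (⁅ v ⁆ ∪ S)))

IsMinSize : {n : ℕ} → (Subset n → Set) → ℕ → Set
IsMinSize P m = (∃[ S ] (P S × ∣ S ∣ ≡ m)) × (∀ S → P S → m ≤ ∣ S ∣)

module Submission where

open import Defs
open import Data.Nat using (ℕ; _≤_)
open import Data.Fin.Subset using (Subset; ⊤)
open import Data.Product using (_×_; ∃-syntax; _,_; proj₂)
open import Relation.Binary.PropositionalEquality using (subst)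

-- Every split dominating, split irredundant or split independent set is in
-- particular a vertex cut set, and a minimum over a subfamily is at least the
-- minimum over the whole family.

IsMinSize-mono : ∀ {n} {P Q : Subset n → Set} {k m : ℕ} →
                 (∀ S → Q S → P S) → IsMinSize P k → IsMinSize Q m → k ≤ m
IsMinSize-mono Q⇒P (_ , k-min) ((S , QS , ∣S∣≡m) , _) =
  subst (_ ≤_) ∣S∣≡m (k-min S (Q⇒P S QS))

module _ {n : ℕ} (G : Graph n) where

  splitDominating⇒vertexCutSet : ∀ S → SplitDominating G S → VertexCutSet G S
  splitDominating⇒vertexCutSet _ = proj₂

  maximalSplitIrredundant⇒vertexCutSet :
    ∀ S → MaximalSplitIrredundant G S → VertexCutSet G S
  maximalSplitIrredundant⇒vertexCutSet _ ((_ , split) , _) = split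

  maximalSplitIndependent⇒vertexCutSet :
    ∀ S → MaximalSplitIndependent G S → VertexCutSet G S
  maximalSplitIndependent⇒vertexCutSet _ ((_ , split) , _) = split

mainTheorem7 : (n : ℕ) (G : Graph n) →
    Connected G ⊤ → NoIsolated G →
    ((k γs : ℕ) → IsMinSize (VertexCutSet G) k → IsMinSize (SplitDominating G) γs → k ≤ γs)
    × ((∃[ S ] SplitIrredundant G S) →
        (k irs : ℕ) → IsMinSize (VertexCutSet G) k → IsMinSize (MaximalSplitIrredundant G) irs → k ≤ irs)
    × ((∃[ S ] SplitIndependent G S) →
        (k is : ℕ) → IsMinSize (VertexCutSet G) k → IsMinSize (MaximalSplitIndependent G) is → k ≤ is)
mainTheorem7 n G _ _ =
    (λ _ _ → IsMinSize-mono (splitDominating⇒vertexCutSet G))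
  , (λ _ _ _ → IsMinSize-mono (maximalSplitIrredundant⇒vertexCutSet G))
  , (λ _ _ _ → IsMinSize-mono (maximalSplitIndependent⇒vertexCutSet G))
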